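{- Let $G_1=(V_1,E_1)$ and $G_2=(V_2,E_2)$ be simple, finite, connected graphs. The following are equivalent: (i) $G_1$ and $G_2$ are reflective; (ii) the cartesian product $G_1\times G_2$ is reflective.
   Context: For a graph with distance $d$ and adjacent $x\sim y$ let $V_x^y=\{x': d(x',x)<d(x',y)\}$, $V^{xy}=\{z: d(z,x)=d(z,y)\}$. A reflection from $x$ to $y$ is a graph automorphism $\phi$ with $\phi^2=\mathrm{id}$, $\phi(x)=y$, such that the set of edges between $V_x^y$ and $V_y^x$ is exactly $\{(x',\phi(x')):x'\in V_x^y\}$, and $\phi$ fixes every vertex of $V^{xy}$. A graph is reflective if a reflection from $x$ to $y$ exists for every edge $x\sim y$. -}

module Defs where

open import Data.Nat using (ℕ; zero; suc; _<_; _*_)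
open import Data.Fin using (Fin; remQuot) renaming (_≟_ to _≟ᶠ_)
open import Data.Bool using (Bool; T; _∧_; _∨_; true; false)
open import Data.Unit using (tt)
open import Data.Empty using (⊥-elim)
open import Data.Product using (Σ; ∃; ∃-syntax; _×_; _,_; proj₁; proj₂)
open import Relation.Nullary using (¬_; yes; no)
open import Relation.Nullary.Decidable using (⌊_⌋)
open import Relation.Binary.PropositionalEquality using (_≡_; refl; subst) renaming (sym to ≡-sym)

record Graph : Set where
  field
    n      : ℕ
    adj    : Fin n → Fin n → Bool
    sym    : ∀ u v → adj u v ≡ adj v u
    irrefl : ∀ v → ¬ T (adj v v)

module _ (G : Graph) where
  open Graph G

  V : Set
  V = Fin n

  Adj : V → V → Set
  Adj u v = T (adj u v)

  data Walk : V → V → ℕ → Set where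
    nil  : ∀ {x} → Walk x x zero
    cons : ∀ {x y z k} → Adj x y → Walk y z k → Walk x z (suc k)

  Dist : V → V → ℕ → Set
  Dist x y k = Walk x y k × (∀ m → m < k → ¬ Walk x y m)

  -- connected (and nonempty)
  Connected : Set
  Connected = Fin n × (∀ u v → ∃[ k ] Walk u v k)

  Closer : V → V → V → Set
  Closer x y z = ∃[ k ] ∃[ l ] (Dist z x k × Dist z y l × k < l)

  Equidistant : V → V → V → Set
  Equidistant x y z = ∃[ k ] (Dist z x k × Dist z y k)

  record IsReflection (x y : V) (φ : V → V) : Set where
    field
      involutive  : ∀ v → φ (φ v) ≡ v
      preserves   : ∀ u v → Adj u v → Adj (φ u) (φ v)
      reflects    : ∀ u v → Adj (φ u) (φ v) → Adj u v
      maps-x      : φ x ≡ y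
      image-side  : ∀ x' → Closer x y x' → Closer y x (φ x')
      image-edge  : ∀ x' → Closer x y x' → Adj x' (φ x')
      only-edges  : ∀ x' y' → Closer x y x' → Closer y x y' → Adj x' y' → y' ≡ φ x'
      fixes       : ∀ z → Equidistant x y z → φ z ≡ z

  Reflective : Set
  Reflective = ∀ x y → Adj x y → Σ (V → V) (IsReflection x y)

-- cartesian product; vertex k of Fin (n₁ * n₂) is the pair remQuot n₂ k
_□_ : Graph → Graph → Graph
G₁ □ G₂ = record
  { n = n₁ * n₂
  ; adj = λ u v → padj (remQuot n₂ u) (remQuot n₂ v)
  ; sym = λ u v → psym (remQuot n₂ u) (remQuot n₂ v)
  ; irrefl = λ v → pirr (remQuot n₂ v)
  }
  where
  open Graph G₁ renaming (n to n₁; adj to adj₁; sym to sym₁; irrefl to irr₁)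
  open Graph G₂ renaming (n to n₂; adj to adj₂; sym to sym₂; irrefl to irr₂)
  padj : Fin n₁ × Fin n₂ → Fin n₁ × Fin n₂ → Bool
  padj (a , b) (a' , b') = (⌊ a ≟ᶠ a' ⌋ ∧ adj₂ b b') ∨ (⌊ b ≟ᶠ b' ⌋ ∧ adj₁ a a')
  eqsym : ∀ {m} (a a' : Fin m) → ⌊ a ≟ᶠ a' ⌋ ≡ ⌊ a' ≟ᶠ a ⌋
  eqsym a a' with a ≟ᶠ a' | a' ≟ᶠ a
  ... | yes _ | yes _ = refl
  ... | no _  | no _  = refl
  ... | yes p | no q  = ⊥-elim (q (≡-sym p))
  ... | no p  | yes q = ⊥-elim (p (≡-sym q))
  psym : ∀ u v → padj u v ≡ padj v u
  psym (a , b) (a' , b') rewrite eqsym a a' | eqsym b b' | sym₁ a a' | sym₂ b b' = refl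
  pirr : ∀ u → ¬ T (padj u u)
  pirr (a , b) h with a ≟ᶠ a | b ≟ᶠ b
  ... | no p  | _     = p refl
  ... | yes _ | no q  = q refl
  ... | yes _ | yes _ with adj₂ b b in e₂ | adj₁ a a in e₁
  ...   | true  | _     = irr₂ b (subst T (≡-sym e₂) tt)
  ...   | false | true  = irr₁ a (subst T (≡-sym e₁) tt)
  ...   | false | false = h

module Submission where

-- Distances in a cartesian product add coordinatewise. Hence for an edge x = (a,b) ~ y = (a',b)
-- along G, the sets V_x^y, V_y^x and V^{xy} are those of a ~ a' in G times all of H, and a
-- reflection of G from a to a' acts coordinatewise as a reflection of the product. Conversely
-- a reflection Φ of the product from x to y maps the fibre G × {b} to itself (G being connected,
-- each vertex of the fibre lies in V_x^y, V_y^x or V^{xy}), and restricts there to a reflection of G.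

open import Defs
open import Data.Product using (_×_)
open import Function.Bundles using (_⇔_)

open import Data.Bool using (T; _∧_; _∨_)
open import Data.Bool.Properties using (T-∨; T-∧)
open import Data.Empty using (⊥-elim)
open import Data.Fin using (Fin; combine; remQuot) renaming (_≟_ to _≟ᶠ_)
open import Data.Fin.Properties using (remQuot-combine; combine-remQuot; any?)
open import Data.Nat using (ℕ; zero; suc; _+_; _<_; s≤s)
open import Data.Nat.Properties
  using (<-cmp; <-asym; <-irrefl; ≮⇒≥; <-≤-trans; +-mono-≤; +-monoˡ-<; +-monoʳ-<; +-cancelʳ-≡; +-cancelʳ-<; +-suc)
open import Data.Product using (Σ; ∃-syntax; _,_; proj₁; proj₂; swap; uncurry)
open import Data.Product.Function.NonDependent.Propositional using (_×-⇔_)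
open import Data.Sum using (_⊎_; inj₁; inj₂) renaming (swap to ⊎-swap)
open import Data.Sum.Function.Propositional using (_⊎-⇔_)
open import Function.Bundles using (Equivalence; mk⇔)
open import Function.Construct.Composition using (_⇔-∘_)
open import Function.Construct.Identity using (⇔-id)
open import Function.Properties.Equivalence using (⇔-isEquivalence)
open import Relation.Binary using (tri<; tri≈; tri>)
open import Relation.Binary.PropositionalEquality
open import Relation.Binary.Structures using (IsEquivalence)
open import Relation.Nullary using (¬_; Dec; yes; no)
open import Relation.Nullary.Decidable using (⌊_⌋; map′; _×-dec_; T?; toWitness; fromWitness)

least-witness : ∀ {p} {Q : ℕ → Set p} → (∀ m → Dec (Q m)) →
                ∀ {k} → Q k → ∃[ j ] (Q j × (∀ m → m < j → ¬ Q m))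
least-witness Q? {zero} q = zero , q , λ _ ()
least-witness Q? {suc k} q with Q? zero
... | yes q₀ = zero , q₀ , λ _ ()
... | no ¬q₀ with least-witness (λ m → Q? (suc m)) q
...   | j , qj , below = suc j , qj , λ { zero _ → ¬q₀ ; (suc m) (s≤s m<j) → below m m<j }

module _ {G : Graph} where
  open Graph G using (adj)

  _++ʷ_ : ∀ {x y z k l} → Walk G x y k → Walk G y z l → Walk G x z (k + l)
  nil      ++ʷ q = q
  cons e p ++ʷ q = cons e (p ++ʷ q)

  walk? : ∀ m x y → Dec (Walk G x y m)
  walk? zero x y with x ≟ᶠ y
  ... | yes refl = yes nil
  ... | no x≢y   = no λ { nil → x≢y refl }
  walk? (suc m) x y =
    map′ (λ { (z , e , w) → cons e w }) (λ { (cons {y = z} e w) → z , e , w })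
         (any? λ z → T? (adj x z) ×-dec walk? m z y)

  walk⇒dist : ∀ {x y k} → Walk G x y k → ∃[ j ] Dist G x y j
  walk⇒dist = least-witness (λ m → walk? m _ _)

  dist-unique : ∀ {x y k l} → Dist G x y k → Dist G x y l → k ≡ l
  dist-unique {k = k} {l} (p , p-min) (q , q-min) with <-cmp k l
  ... | tri< k<l _ _ = ⊥-elim (q-min k k<l p)
  ... | tri≈ _ k≡l _ = k≡l
  ... | tri> _ _ l<k = ⊥-elim (p-min l l<k q)

  closer-asym : ∀ {x y z} → Closer G x y z → ¬ Closer G y x z
  closer-asym (k , l , dk , dl , k<l) (k' , l' , dk' , dl' , k'<l') =
    <-asym k<l (subst₂ _<_ (dist-unique dk' dl) (dist-unique dl' dk) k'<l')

  module _ {φ : V G → V G} (involutive : ∀ v → φ (φ v) ≡ v)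
           (preserves : ∀ u v → Adj G u v → Adj G (φ u) (φ v)) where

    walk-map : ∀ {x y k} → Walk G x y k → Walk G (φ x) (φ y) k
    walk-map nil        = nil
    walk-map (cons e p) = cons (preserves _ _ e) (walk-map p)

    dist-map : ∀ {x y k} → Dist G x y k → Dist G (φ x) (φ y) k
    dist-map {x} {y} (p , p-min) =
      walk-map p , λ m m<k q →
        p-min m m<k (subst₂ (λ s t → Walk G s t m) (involutive x) (involutive y) (walk-map q))

    closer-map : ∀ {x y z} → Closer G x y z → Closer G (φ x) (φ y) (φ z)
    closer-map (k , l , dk , dl , k<l) = k , l , dist-map dk , dist-map dl , k<l

record CartesianProduct (G H P : Graph) : Set where
  field
    pair       : V G → V H → V P
    split      : V P → V G × V H
    split-pair : ∀ a b → split (pair a b) ≡ (a , b)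
    pair-split : ∀ u → uncurry pair (split u) ≡ u
    adj-pairˡ  : ∀ {a a'} b → Adj G a a' → Adj P (pair a b) (pair a' b)
    adj-pairʳ  : ∀ a {b b'} → Adj H b b' → Adj P (pair a b) (pair a b')
    adj-unpair : ∀ {a a' b b'} → Adj P (pair a b) (pair a' b') →
                 (a ≡ a' × Adj H b b') ⊎ (b ≡ b' × Adj G a a')

swap-product : ∀ {G H P} → CartesianProduct G H P → CartesianProduct H G P
swap-product π = record
  { pair       = λ b a → pair a b
  ; split      = λ u → swap (split u)
  ; split-pair = λ b a → cong swap (split-pair a b)
  ; pair-split = pair-split
  ; adj-pairˡ  = λ a → adj-pairʳ a
  ; adj-pairʳ  = λ b → adj-pairˡ b
  ; adj-unpair = λ e → ⊎-swap (adj-unpair e)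
  }
  where
  open CartesianProduct π

module CartesianProductProperties {G H P : Graph} (π : CartesianProduct G H P) where
  open CartesianProduct π

  fst : V P → V G
  fst u = proj₁ (split u)

  snd : V P → V H
  snd u = proj₂ (split u)

  fst-pair : ∀ a b → fst (pair a b) ≡ a
  fst-pair a b = cong proj₁ (split-pair a b)

  snd-pair : ∀ a b → snd (pair a b) ≡ b
  snd-pair a b = cong proj₂ (split-pair a b)

  pair-injectiveˡ : ∀ {a b a' b'} → pair a b ≡ pair a' b' → a ≡ a'
  pair-injectiveˡ {a} {b} {a'} {b'} e = trans (sym (fst-pair a b)) (trans (cong fst e) (fst-pair a' b'))

  pair-elim : ∀ {ℓ} (Q : V P → Set ℓ) → (∀ c d → Q (pair c d)) → ∀ u → Q u
  pair-elim Q f u = subst Q (pair-split u) (f (fst u) (snd u))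

  pair-elim₂ : ∀ {ℓ} (Q : V P → V P → Set ℓ) → (∀ c d c' d' → Q (pair c d) (pair c' d')) → ∀ u v → Q u v
  pair-elim₂ Q f u v = subst₂ Q (pair-split u) (pair-split v) (f (fst u) (snd u) (fst v) (snd v))

  adj-split : ∀ {u w} → Adj P u w →
              (fst u ≡ fst w × Adj H (snd u) (snd w)) ⊎ (snd u ≡ snd w × Adj G (fst u) (fst w))
  adj-split {u} {w} e = adj-unpair (subst₂ (Adj P) (sym (pair-split u)) (sym (pair-split w)) e)

  adj-in-fibre : ∀ {c c' d} → Adj P (pair c d) (pair c' d) → Adj G c c'
  adj-in-fibre {d = d} e with adj-unpair e
  ... | inj₁ (_ , d~d) = ⊥-elim (Graph.irrefl H d d~d)
  ... | inj₂ (_ , c~c') = c~c'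

  walk-pairˡ : ∀ {a a' k} b → Walk G a a' k → Walk P (pair a b) (pair a' b) k
  walk-pairˡ b nil        = nil
  walk-pairˡ b (cons e p) = cons (adj-pairˡ b e) (walk-pairˡ b p)

  walk-pairʳ : ∀ a {b b' k} → Walk H b b' k → Walk P (pair a b) (pair a b') k
  walk-pairʳ a nil        = nil
  walk-pairʳ a (cons e p) = cons (adj-pairʳ a e) (walk-pairʳ a p)

  walk-pair : ∀ {a a' b b' k l} → Walk G a a' k → Walk H b b' l → Walk P (pair a b) (pair a' b') (k + l)
  walk-pair {a' = a'} {b = b} p q = walk-pairˡ b p ++ʷ walk-pairʳ a' q

  walk-split : ∀ {u v m} → Walk P u v m →
               ∃[ k ] ∃[ l ] (Walk G (fst u) (fst v) k × Walk H (snd u) (snd v) l × k + l ≡ m)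
  walk-split nil = 0 , 0 , nil , nil , refl
  walk-split {v = v} (cons e p) with walk-split p | adj-split e
  ... | k , l , p₁ , p₂ , k+l≡m | inj₁ (fst≡ , e₂) =
    k , suc l , subst (λ s → Walk G s (fst v) k) (sym fst≡) p₁ , cons e₂ p₂ , trans (+-suc k l) (cong suc k+l≡m)
  ... | k , l , p₁ , p₂ , k+l≡m | inj₂ (snd≡ , e₁) =
    suc k , l , cons e₁ p₁ , subst (λ s → Walk H s (snd v) l) (sym snd≡) p₂ , cong suc k+l≡m

  walk-unpair : ∀ {a b a' b' m} → Walk P (pair a b) (pair a' b') m →
                ∃[ k ] ∃[ l ] (Walk G a a' k × Walk H b b' l × k + l ≡ m)
  walk-unpair {a} {b} {a'} {b'} w with walk-split w
  ... | k , l , p₁ , p₂ , k+l≡m =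
    k , l , subst₂ (λ s t → Walk G s t k) (fst-pair a b) (fst-pair a' b') p₁ ,
            subst₂ (λ s t → Walk H s t l) (snd-pair a b) (snd-pair a' b') p₂ , k+l≡m

  dist-pair : ∀ {a a' b b' k l} → Dist G a a' k → Dist H b b' l → Dist P (pair a b) (pair a' b') (k + l)
  dist-pair {k = k} {l} (p , p-min) (q , q-min) = walk-pair p q , λ m m<k+l w → no-shorter m<k+l (walk-unpair w)
    where
    no-shorter : ∀ {m} → m < k + l → ¬ (∃[ k' ] ∃[ l' ] (Walk G _ _ k' × Walk H _ _ l' × k' + l' ≡ m))
    no-shorter m<k+l (k' , l' , p' , q' , refl) =
      <-irrefl refl (<-≤-trans m<k+l (+-mono-≤ (≮⇒≥ λ lt → p-min k' lt p') (≮⇒≥ λ lt → q-min l' lt q')))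

  dist-unpair : ∀ {a a' b b' m} → Dist P (pair a b) (pair a' b') m →
                ∃[ k ] ∃[ l ] (Dist G a a' k × Dist H b b' l × k + l ≡ m)
  dist-unpair (w , w-min) with walk-unpair w
  ... | k , l , p , q , refl =
    k , l , (p , λ j j<k p' → w-min (j + l) (+-monoˡ-< l j<k) (walk-pair p' q))
          , (q , λ j j<l q' → w-min (k + j) (+-monoʳ-< k j<l) (walk-pair p q')) , refl

  closer-unpair : ∀ {a a' b c d} → Closer P (pair a b) (pair a' b) (pair c d) →
                  Closer G a a' c × ∃[ l ] Dist H d b l
  closer-unpair (_ , _ , dk , dk' , lt) with dist-unpair dk | dist-unpair dk'
  ... | k , l , d₁ , dl , refl | k' , l' , d₁' , dl' , refl with dist-unique dl dl'
  ... | refl = (k , k' , d₁ , d₁' , +-cancelʳ-< l k k' lt) , l , dl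

  closer-pair : ∀ {a a' b c d l} → Closer G a a' c → Dist H d b l → Closer P (pair a b) (pair a' b) (pair c d)
  closer-pair {l = l} (k , k' , dk , dk' , k<k') dl =
    k + l , k' + l , dist-pair dk dl , dist-pair dk' dl , +-monoˡ-< l k<k'

  equidistant-pair : ∀ {a a' b c d l} → Equidistant G a a' c → Dist H d b l →
                     Equidistant P (pair a b) (pair a' b) (pair c d)
  equidistant-pair {l = l} (k , dk , dk') dl = k + l , dist-pair dk dl , dist-pair dk' dl

  equidistant-unpair : ∀ {a a' b c d} → Equidistant P (pair a b) (pair a' b) (pair c d) → Equidistant G a a' c
  equidistant-unpair (_ , dk , dk') with dist-unpair dk | dist-unpair dk'
  ... | k , l , d₁ , dl , e | k' , l' , d₁' , dl' , e' with dist-unique dl dl'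
  ... | refl = k , d₁ , subst (Dist G _ _) (sym (+-cancelʳ-≡ l k k' (trans e (sym e')))) d₁'

  -- An edge across the bisector of a G-edge cannot be an H-edge, since its common
  -- G-coordinate would then lie strictly closer to each end of the G-edge than to the other.
  crossing-edge-in-fibre : ∀ {a a' b c d c' d'} → Closer P (pair a b) (pair a' b) (pair c d) →
                           Closer P (pair a' b) (pair a b) (pair c' d') → Adj P (pair c d) (pair c' d') →
                           d ≡ d' × Adj G c c'
  crossing-edge-in-fibre cl cl' e with adj-unpair e
  ... | inj₁ (refl , _) = ⊥-elim (closer-asym (proj₁ (closer-unpair cl)) (proj₁ (closer-unpair cl')))
  ... | inj₂ d≡d'×c~c'  = d≡d'×c~c'

  mapˡ : (V G → V G) → V P → V P
  mapˡ φ u = pair (φ (fst u)) (snd u)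

  mapˡ-pair : ∀ φ c d → mapˡ φ (pair c d) ≡ pair (φ c) d
  mapˡ-pair φ c d = cong₂ (λ s t → pair (φ s) t) (fst-pair c d) (snd-pair c d)

  restrict : V H → (V P → V P) → V G → V G
  restrict b Φ c = fst (Φ (pair c b))

  module _ {a a' : V G} {b : V H} where
    private
      x y : V P
      x = pair a b
      y = pair a' b

      dist-b-b : Dist H b b 0
      dist-b-b = nil , λ _ ()

    lift-reflection : ∀ {φ} → IsReflection G a a' φ → IsReflection P x y (mapˡ φ)
    lift-reflection {φ} R = record
      { involutive = pair-elim (λ v → Φ (Φ v) ≡ v) λ c d → begin
          Φ (Φ (pair c d))  ≡⟨ cong Φ (Φ-pair c d) ⟩
          Φ (pair (φ c) d)  ≡⟨ Φ-pair (φ c) d ⟩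
          pair (φ (φ c)) d  ≡⟨ cong (λ s → pair s d) (involutive c) ⟩
          pair c d          ∎
      ; preserves = pair-elim₂ (λ u v → Adj P u v → Adj P (Φ u) (Φ v)) λ c d c' d' e →
          subst₂ (Adj P) (sym (Φ-pair c d)) (sym (Φ-pair c' d')) (preserves-pair (adj-unpair e))
      ; reflects = pair-elim₂ (λ u v → Adj P (Φ u) (Φ v) → Adj P u v) λ c d c' d' e →
          reflects-pair (adj-unpair (subst₂ (Adj P) (Φ-pair c d) (Φ-pair c' d') e))
      ; maps-x = trans (Φ-pair a b) (cong (λ s → pair s b) maps-x)
      ; image-side = pair-elim (λ z → Closer P x y z → Closer P y x (Φ z)) λ c d cl →
          subst (Closer P y x) (sym (Φ-pair c d)) (image-side-pair (closer-unpair cl))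
      ; image-edge = pair-elim (λ z → Closer P x y z → Adj P z (Φ z)) λ c d cl →
          subst (Adj P (pair c d)) (sym (Φ-pair c d)) (adj-pairˡ d (image-edge c (proj₁ (closer-unpair cl))))
      ; only-edges = pair-elim₂ (λ u v → Closer P x y u → Closer P y x v → Adj P u v → v ≡ Φ u)
          λ c d c' d' cl cl' e → trans (only-edges-pair cl cl' (crossing-edge-in-fibre cl cl' e)) (sym (Φ-pair c d))
      ; fixes = pair-elim (λ z → Equidistant P x y z → Φ z ≡ z) λ c d eq →
          trans (Φ-pair c d) (cong (λ s → pair s d) (fixes c (equidistant-unpair eq)))
      }
      where
      open IsReflection R
      open ≡-Reasoning

      Φ : V P → V P
      Φ = mapˡ φ

      Φ-pair : ∀ c d → Φ (pair c d) ≡ pair (φ c) d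
      Φ-pair = mapˡ-pair φ

      φ-injective : ∀ {c c'} → φ c ≡ φ c' → c ≡ c'
      φ-injective {c} {c'} e = trans (sym (involutive c)) (trans (cong φ e) (involutive c'))

      preserves-pair : ∀ {c d c' d'} → (c ≡ c' × Adj H d d') ⊎ (d ≡ d' × Adj G c c') →
                       Adj P (pair (φ c) d) (pair (φ c') d')
      preserves-pair {c} (inj₁ (refl , e₂)) = adj-pairʳ (φ c) e₂
      preserves-pair {d = d} (inj₂ (refl , e₁)) = adj-pairˡ d (preserves _ _ e₁)

      reflects-pair : ∀ {c d c' d'} → (φ c ≡ φ c' × Adj H d d') ⊎ (d ≡ d' × Adj G (φ c) (φ c')) →
                      Adj P (pair c d) (pair c' d')
      reflects-pair {c} {d} {d' = d'} (inj₁ (φc≡φc' , e₂)) =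
        subst (λ s → Adj P (pair c d) (pair s d')) (φ-injective φc≡φc') (adj-pairʳ c e₂)
      reflects-pair {d = d} (inj₂ (refl , e₁)) = adj-pairˡ d (reflects _ _ e₁)

      image-side-pair : ∀ {c d} → Closer G a a' c × ∃[ l ] Dist H d b l → Closer P y x (pair (φ c) d)
      image-side-pair (cl , _ , dl) = closer-pair (image-side _ cl) dl

      only-edges-pair : ∀ {c d c' d'} → Closer P x y (pair c d) → Closer P y x (pair c' d') → d ≡ d' × Adj G c c' →
                        pair c' d' ≡ pair (φ c) d
      only-edges-pair {d = d} cl cl' (refl , e₁) =
        cong (λ s → pair s d) (only-edges _ _ (proj₁ (closer-unpair cl)) (proj₁ (closer-unpair cl')) e₁)

    module _ (conn : Connected G) {Φ : V P → V P} (R : IsReflection P x y Φ) where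
      open IsReflection R

      -- Φ maps the G-fibre through x and y to itself: a vertex of that fibre is either
      -- fixed, or joined to its image by an edge crossing the bisector, which stays in the fibre.
      reflection-preserves-fibre : ∀ c → Φ (pair c b) ≡ pair (restrict b Φ c) b
      reflection-preserves-fibre c = trans (sym (pair-split _)) (cong (pair (restrict b Φ c)) snd-fixed)
        where
        Φ-y : Φ y ≡ x
        Φ-y = trans (cong Φ (sym maps-x)) (involutive x)

        crossing-snd : ∀ u w → Closer P x y u → Closer P y x w → Adj P u w → snd u ≡ snd w
        crossing-snd = pair-elim₂ (λ u w → Closer P x y u → Closer P y x w → Adj P u w → snd u ≡ snd w)
          λ c d c' d' cl cl' e → begin
            snd (pair c d)    ≡⟨ snd-pair c d ⟩
            d                 ≡⟨ proj₁ (crossing-edge-in-fibre cl cl' e) ⟩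
            d'                ≡⟨ snd-pair c' d' ⟨
            snd (pair c' d')  ∎
          where open ≡-Reasoning

        snd-fixed : snd (Φ (pair c b)) ≡ b
        snd-fixed with walk⇒dist (proj₂ (proj₂ conn c a)) | walk⇒dist (proj₂ (proj₂ conn c a'))
        ... | k , dk | l , dl with <-cmp k l
        ... | tri< k<l _ _ =
          let cl = closer-pair (k , l , dk , dl , k<l) dist-b-b in
          trans (sym (crossing-snd _ _ cl (image-side _ cl) (image-edge _ cl))) (snd-pair c b)
        ... | tri≈ _ refl _ = trans (cong snd (fixes _ (equidistant-pair (k , dk , dl) dist-b-b))) (snd-pair c b)
        ... | tri> _ _ l<k =
          let w   = Φ (pair c b)
              clw = subst₂ (λ s t → Closer P s t w) Φ-y maps-x
                      (closer-map involutive preserves (closer-pair (l , k , dl , dk , l<k) dist-b-b))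
          in trans (crossing-snd _ _ clw (image-side w clw) (image-edge w clw))
                   (trans (cong snd (involutive _)) (snd-pair c b))

      restrict-reflection : IsReflection G a a' (restrict b Φ)
      restrict-reflection = record
        { involutive = λ c → pair-injectiveˡ (begin
            pair (ψ (ψ c)) b    ≡⟨ K (ψ c) ⟨
            Φ (pair (ψ c) b)    ≡⟨ cong Φ (K c) ⟨
            Φ (Φ (pair c b))    ≡⟨ involutive (pair c b) ⟩
            pair c b            ∎)
        ; preserves = λ c e c~e →
            adj-in-fibre (subst₂ (Adj P) (K c) (K e) (preserves _ _ (adj-pairˡ b c~e)))
        ; reflects = λ c e ψc~ψe →
            adj-in-fibre (reflects _ _ (subst₂ (Adj P) (sym (K c)) (sym (K e)) (adj-pairˡ b ψc~ψe)))
        ; maps-x = pair-injectiveˡ (trans (sym (K a)) maps-x)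
        ; image-side = λ c cl →
            proj₁ (closer-unpair (subst (Closer P y x) (K c) (image-side _ (closer-pair cl dist-b-b))))
        ; image-edge = λ c cl →
            adj-in-fibre (subst (Adj P (pair c b)) (K c) (image-edge _ (closer-pair cl dist-b-b)))
        ; only-edges = λ c e cl cl' c~e → pair-injectiveˡ
            (trans (only-edges _ _ (closer-pair cl dist-b-b) (closer-pair cl' dist-b-b) (adj-pairˡ b c~e)) (K c))
        ; fixes = λ c eq → pair-injectiveˡ (trans (sym (K c)) (fixes _ (equidistant-pair eq dist-b-b)))
        }
        where
        open ≡-Reasoning

        ψ : V G → V G
        ψ = restrict b Φ

        K : ∀ c → Φ (pair c b) ≡ pair (ψ c) b
        K = reflection-preserves-fibre

module _ {G H P : Graph} (π : CartesianProduct G H P) where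
  open CartesianProduct π
  open CartesianProductProperties

  reflective-product : Reflective G → Reflective H → Reflective P
  reflective-product RG RH = pair-elim₂ π (λ u v → Adj P u v → Σ (V P → V P) (IsReflection P u v))
    λ c d c' d' e → reflection-along (adj-unpair e)
    where
    reflection-along : ∀ {c d c' d'} → (c ≡ c' × Adj H d d') ⊎ (d ≡ d' × Adj G c c') →
                       Σ (V P → V P) (IsReflection P (pair c d) (pair c' d'))
    reflection-along (inj₁ (refl , e₂)) = _ , lift-reflection (swap-product π) (proj₂ (RH _ _ e₂))
    reflection-along (inj₂ (refl , e₁)) = _ , lift-reflection π (proj₂ (RG _ _ e₁))

  factor-reflective : Connected G → V H → Reflective P → Reflective G
  factor-reflective conn b RP a a' e = _ , restrict-reflection π conn (proj₂ (RP _ _ (adj-pairˡ b e)))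

module _ (G₁ G₂ : Graph) where
  open Graph G₁ using () renaming (n to n₁; adj to adj₁)
  open Graph G₂ using () renaming (n to n₂; adj to adj₂)

  private
    AdjPair : Fin n₁ × Fin n₂ → Fin n₁ × Fin n₂ → Set
    AdjPair (a , b) (a' , b') = T ((⌊ a ≟ᶠ a' ⌋ ∧ adj₂ b b') ∨ (⌊ b ≟ᶠ b' ⌋ ∧ adj₁ a a'))

    T-≟ : ∀ {m} {i j : Fin m} → T ⌊ i ≟ᶠ j ⌋ ⇔ (i ≡ j)
    T-≟ = mk⇔ toWitness fromWitness

  □-adj-combine : ∀ {a a' b b'} → Adj (G₁ □ G₂) (combine a b) (combine a' b') ⇔
                  ((a ≡ a' × Adj G₂ b b') ⊎ (b ≡ b' × Adj G₁ a a'))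
  □-adj-combine {a} {a'} {b} {b'} =
    (((T-≟ ×-⇔ ⇔-id _) ⇔-∘ T-∧) ⊎-⇔ ((T-≟ ×-⇔ ⇔-id _) ⇔-∘ T-∧)) ⇔-∘ (T-∨ ⇔-∘
      IsEquivalence.reflexive ⇔-isEquivalence (cong₂ AdjPair (remQuot-combine a b) (remQuot-combine a' b')))

  □-cartesianProduct : CartesianProduct G₁ G₂ (G₁ □ G₂)
  □-cartesianProduct = record
    { pair       = combine
    ; split      = remQuot n₂
    ; split-pair = remQuot-combine
    ; pair-split = combine-remQuot {n₁} n₂
    ; adj-pairˡ  = λ b e → Equivalence.from □-adj-combine (inj₂ (refl , e))
    ; adj-pairʳ  = λ a e → Equivalence.from □-adj-combine (inj₁ (refl , e))
    ; adj-unpair = Equivalence.to □-adj-combine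
    }

lemma2p8 : (G₁ G₂ : Graph) → Connected G₁ → Connected G₂ →
    (Reflective G₁ × Reflective G₂) ⇔ Reflective (G₁ □ G₂)
lemma2p8 G₁ G₂ conn₁ conn₂ = mk⇔
  (λ (R₁ , R₂) → reflective-product π R₁ R₂)
  (λ R → factor-reflective π conn₁ (proj₁ conn₂) R , factor-reflective (swap-product π) conn₂ (proj₁ conn₁) R)
  where
  π : CartesianProduct G₁ G₂ (G₁ □ G₂)
  π = □-cartesianProduct G₁ G₂
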